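{- For every integer $k\ge 2$ and every $\ell\in\{1,2\}$, there exists a cop-winning (undirected) edge periodic cycle $\mathcal{G}=(V,E,\tau)$ with $\max(L_{\mathcal{G}})=k$ and $|V| = 2\cdot \ell\cdot \mathrm{LCM}(L_{\mathcal{G}})-1$.
   Context: An edge periodic graph $\mathcal{G}=(V,E,\tau)$ consists of a finite undirected graph $G=(V,E)$ and a function $\tau: E\to\{0,1\}^*$ such that edge $e$ exists in time step $t\ge 0$ if and only if $\tau(e)[t \bmod |\tau(e)|]=1$; every edge exists in at least one time step. An edge periodic cycle is one whose underlying graph $G$ is a single cycle. $L_{\mathcal{G}}=\{|\tau(e)| : e\in E\}$ is the set of edge periods, $\max(L_{\mathcal{G}})$ its maximum and $\mathrm{LCM}(L_{\mathcal{G}})$ its least common multiple. The one-cop game: first the cop chooses a start vertex, then the robber; then in each time step $t=0,1,2,\dots$, first the cop and then the robber either stays or moves to an adjacent vertex along an edge present at time $t$. The cop catches the robber if after the cop's move in some time step both are on the same vertex. $\mathcal{G}$ is cop-winning if the cop has a strategy (including start vertex) catching the robber regardless of the robber's start vertex and moves. -}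

module Defs where

open import Data.Nat using (ℕ; zero; suc; _≤_; _⊔_; _%_)
open import Data.Nat.DivMod using (m%n<n)
open import Data.Nat.LCM using (lcm)
open import Data.Fin using (Fin; toℕ; fromℕ<)
open import Data.Bool using (Bool; true; false)
open import Data.List using (List; []; _∷_; length; lookup; tabulate; foldr)
open import Data.List.Membership.Propositional using (_∈_)
open import Data.Product using (Σ; _×_)
open import Data.Sum using (_⊎_)
open import Relation.Binary.PropositionalEquality using (_≡_)

at : List Bool → ℕ → Bool
at [] t = false
at (b ∷ bs) t = lookup (b ∷ bs) (fromℕ< (m%n<n t (suc (length bs))))

next : ∀ {n} → Fin n → Fin n
next {suc m} i = fromℕ< (m%n<n (suc (toℕ i)) (suc m))

-- An edge periodic cycle on vertex set V = Fin n (n ≥ 3).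
-- Edge i (for i : Fin n) is the edge {i, i+1 mod n}; τ i is its pattern.
record EPCycle (n : ℕ) : Set where
  field
    n≥3      : 3 ≤ n
    τ        : Fin n → List Bool
    nonempty : ∀ i → 1 ≤ length (τ i)
    occurs   : ∀ i → true ∈ τ i

module _ {n : ℕ} (G : EPCycle n) where
  open EPCycle G

  present : Fin n → ℕ → Set
  present i t = at (τ i) t ≡ true

  Adj : ℕ → Fin n → Fin n → Set
  Adj t u v = (v ≡ next u × present u t) ⊎ (u ≡ next v × present v t)

  Move : ℕ → Fin n → Fin n → Set
  Move t u v = u ≡ v ⊎ Adj t u v

  -- CopWins c r t : at the start of time step t, with cop on c and robber on r,
  -- the cop has a strategy that catches the robber (in finitely many steps)
  -- against every robber behaviour.
  data CopWins : Fin n → Fin n → ℕ → Set where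
    catch : ∀ {c r t} c' → Move t c c' → c' ≡ r → CopWins c r t
    step  : ∀ {c r t} c' → Move t c c' →
            (∀ r' → Move t r r' → CopWins c' r' (suc t)) → CopWins c r t

  CopWinning : Set
  CopWinning = Σ (Fin n) λ c → ∀ r → CopWins c r 0

  -- L_G as a list (with multiplicity) of the edge periods |τ(e)|
  periods : List ℕ
  periods = tabulate (λ i → length (τ i))

  maxL : ℕ
  maxL = foldr _⊔_ 0 periods

  lcmL : ℕ
  lcmL = foldr lcm 1 periods

{-# OPTIONS --safe #-}
module Submission where

open import Defs
open import Data.Nat using (ℕ; zero; suc; _+_; _*_; _∸_; _≤_; _<_; z≤n; s≤s; _%_; _⊔_; NonZero; >-nonZero)
open import Data.Nat.Properties
open import Data.Nat.DivMod using (m%n<n; n%n≡0; m<n⇒m%n≡m; m%n≤m; m≤n⇒[n∸m]%m≡n%m; [m+n]%n≡m%n)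
open import Data.Nat.Divisibility using (_∣_; ∣-antisym; ∣-refl; 1∣_; ∣⇒≤; n∣m*n; m%n≡0⇒n∣m; n∣m⇒m%n≡0; ∣m+n∣m⇒∣n)
open import Data.Nat.LCM using (lcm; lcm-least; m∣lcm[m,n])
open import Data.Nat.Tactic.RingSolver using (solve-∀)
open import Data.Fin using (Fin; toℕ; fromℕ<) renaming (zero to fzero; suc to fsuc)
open import Data.Fin.Properties using (toℕ-fromℕ<; toℕ-injective; toℕ≤pred[n])
open import Data.Bool using (Bool; true; false)
open import Data.List using (List; []; _∷_; length; lookup; replicate; _++_; tabulate; foldr)
open import Data.List.Properties using (length-replicate; length-++)
open import Data.List.Membership.Propositional using (_∈_)
open import Data.List.Relation.Unary.Any using (here; there)
open import Data.Product using (Σ; _×_; _,_)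
open import Data.Sum using (_⊎_; inj₁; inj₂; [_,_])
open import Data.Empty using (⊥-elim)
open import Function using (_∘′_)
open import Function.Bundles using (_⇔_; mk⇔; Equivalence)
open import Relation.Nullary using (Dec; yes; no; ¬_)
open import Relation.Nullary.Decidable using (_⊎-dec_)
open import Relation.Binary.PropositionalEquality hiding ([_])

open Equivalence using (to; from)

-- All edges get period k, so max and lcm of the periods are both k. The schedules are invariant
-- under the reflection x ↦ −x of the cycle, so against a cop starting at 0 the robber may be
-- assumed to start in the half [0, h], and the cop simply walks right, one vertex per step.
-- With 2k − 1 vertices (h = k − 1) only the edge {h, h + 1} is restricted, open at times ≡ k − 1
-- (mod k): it stays closed until the cop reaches h, so the robber is cornered there.
-- With 4k − 1 vertices (h = 2k − 1) the robber can pass that gate, but not before time k − 1, so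
-- it stays within k of the cop; the two edges at 0, open only at multiples of k, then let it
-- reach 0 so late that the cop gets to the last vertex before they open again and catches it there.

≤∧≢∧≢⇒2+≤ : ∀ {t x} → t ≤ x → x ≢ t → x ≢ suc t → suc (suc t) ≤ x
≤∧≢∧≢⇒2+≤ t≤x x≢t x≢1+t = ≤∧≢⇒< (≤∧≢⇒< t≤x (≢-sym x≢t)) (≢-sym x≢1+t)

m∸n≡o⇒n≡m∸o : ∀ {m n o} → n ≤ m → m ∸ n ≡ o → n ≡ m ∸ o
m∸n≡o⇒n≡m∸o {m} n≤m m∸n≡o = trans (sym (m∸[m∸n]≡n n≤m)) (cong (m ∸_) m∸n≡o)

m≤n⇒m+n%m≤n : ∀ {m n} .{{_ : NonZero m}} → m ≤ n → m + n % m ≤ n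
m≤n⇒m+n%m≤n {m} {n} m≤n = begin
  m + n % m           ≡⟨ cong (m +_) (m≤n⇒[n∸m]%m≡n%m m≤n) ⟨
  m + (n ∸ m) % m     ≤⟨ +-monoʳ-≤ m (m%n≤m (n ∸ m) m) ⟩
  m + (n ∸ m)         ≡⟨ m+[n∸m]≡n m≤n ⟩
  n                   ∎
  where open ≤-Reasoning

∣∧∣∧<⇒+≤ : ∀ {d m n} → d ∣ m → d ∣ n → m < n → m + d ≤ n
∣∧∣∧<⇒+≤ {d} {m} {n} d∣m d∣n m<n = begin
  m + d           ≤⟨ +-monoʳ-≤ m (∣⇒≤ {{>-nonZero (m<n⇒0<n∸m m<n)}} d∣n∸m) ⟩
  m + (n ∸ m)     ≡⟨ m+[n∸m]≡n (<⇒≤ m<n) ⟩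
  n               ∎
  where
    open ≤-Reasoning
    d∣n∸m : d ∣ n ∸ m
    d∣n∸m = ∣m+n∣m⇒∣n (subst (d ∣_) (sym (m+[n∸m]≡n (<⇒≤ m<n))) d∣n) d∣m

1+[m∸1+n]≡m∸n : ∀ {m n} → suc n ≤ m → suc (m ∸ suc n) ≡ m ∸ n
1+[m∸1+n]≡m∸n 1+n≤m = sym (+-∸-assoc 1 1+n≤m)

lcm[n,n]≡n : ∀ n → lcm n n ≡ n
lcm[n,n]≡n n = ∣-antisym (lcm-least ∣-refl ∣-refl) (m∣lcm[m,n] n n)

lcm[n,1]≡n : ∀ n → lcm n 1 ≡ n
lcm[n,1]≡n n = ∣-antisym (lcm-least ∣-refl (1∣ n)) (m∣lcm[m,n] n 1)

lookupℕ : List Bool → ℕ → Bool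
lookupℕ []       _       = false
lookupℕ (x ∷ xs) zero    = x
lookupℕ (x ∷ xs) (suc j) = lookupℕ xs j

lookup≡lookupℕ : ∀ xs (i : Fin (length xs)) → lookup xs i ≡ lookupℕ xs (toℕ i)
lookup≡lookupℕ (x ∷ xs) fzero    = refl
lookup≡lookupℕ (x ∷ xs) (fsuc i) = lookup≡lookupℕ xs i

at-∷ : ∀ x xs {p} t → length xs ≡ p → at (x ∷ xs) t ≡ lookupℕ (x ∷ xs) (t % suc p)
at-∷ x xs t refl = trans (lookup≡lookupℕ (x ∷ xs) (fromℕ< t%n<n)) (cong (lookupℕ (x ∷ xs)) (toℕ-fromℕ< t%n<n))
  where
    t%n<n : t % suc (length xs) < suc (length xs)
    t%n<n = m%n<n t (suc (length xs))

always : ℕ → List Bool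
always k = replicate k true

pulse : ℕ → ℕ → List Bool
pulse a b = replicate a false ++ true ∷ replicate b false

length-pulse : ∀ a b → length (pulse a b) ≡ suc (a + b)
length-pulse a b = begin
  length (pulse a b)                                             ≡⟨ length-++ (replicate a false) ⟩
  length (replicate a false) + suc (length (replicate b false)) ≡⟨ cong₂ (λ u v → u + suc v) (length-replicate a) (length-replicate b) ⟩
  a + suc b                                                      ≡⟨ +-suc a b ⟩
  suc (a + b)                                                    ∎
  where open ≡-Reasoning

lookupℕ-replicate : ∀ {x : Bool} a {j} → j < a → lookupℕ (replicate a x) j ≡ x
lookupℕ-replicate (suc a) {zero}  _         = refl
lookupℕ-replicate (suc a) {suc j} (s≤s j<a) = lookupℕ-replicate a j<a

lookupℕ-replicate-false : ∀ b j → lookupℕ (replicate b false) j ≡ false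
lookupℕ-replicate-false zero    j       = refl
lookupℕ-replicate-false (suc b) zero    = refl
lookupℕ-replicate-false (suc b) (suc j) = lookupℕ-replicate-false b j

lookupℕ-pulse : ∀ a b j → lookupℕ (pulse a b) j ≡ true ⇔ j ≡ a
lookupℕ-pulse zero    b zero    = mk⇔ (λ _ → refl) (λ _ → refl)
lookupℕ-pulse zero    b (suc j) rewrite lookupℕ-replicate-false b j = mk⇔ (λ ()) (λ ())
lookupℕ-pulse (suc a) b zero    = mk⇔ (λ ()) (λ ())
lookupℕ-pulse (suc a) b (suc j) = mk⇔ (cong suc ∘′ to (lookupℕ-pulse a b j)) (from (lookupℕ-pulse a b j) ∘′ suc-injective)

at-always : ∀ a t → at (always (suc a)) t ≡ true
at-always a t rewrite at-∷ true (replicate a true) t (length-replicate a) =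
  lookupℕ-replicate (suc a) (m%n<n t (suc a))

at-pulse : ∀ a b t → at (pulse a b) t ≡ true ⇔ t % suc (a + b) ≡ a
at-pulse zero    b t rewrite at-∷ true  (replicate b false) t (length-replicate b) = lookupℕ-pulse zero b _
at-pulse (suc a) b t rewrite at-∷ false (pulse a b) t (length-pulse a b)         = lookupℕ-pulse (suc a) b _

true∈pulse : ∀ a b → true ∈ pulse a b
true∈pulse zero    b = here refl
true∈pulse (suc a) b = there (true∈pulse a b)

foldr-tabulate-idem : ∀ {n} (_∙_ : ℕ → ℕ → ℕ) {e k} → k ∙ e ≡ k → k ∙ k ≡ k →
                      (f : Fin (suc n) → ℕ) → (∀ i → f i ≡ k) → foldr _∙_ e (tabulate f) ≡ k
foldr-tabulate-idem {zero}  _∙_ k∙e k∙k f f≡k = trans (cong (_∙ _) (f≡k fzero)) k∙e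
foldr-tabulate-idem {suc n} _∙_ k∙e k∙k f f≡k =
  trans (cong₂ _∙_ (f≡k fzero) (foldr-tabulate-idem _∙_ k∙e k∙k (f ∘′ fsuc) (λ i → f≡k (fsuc i)))) k∙k

module _ {n} (G : EPCycle (suc n)) {k} (uniform : ∀ i → length (EPCycle.τ G i) ≡ k) where

  maxL-uniform : maxL G ≡ k
  maxL-uniform = foldr-tabulate-idem _⊔_ (⊔-identityʳ k) (⊔-idem k) _ uniform

  lcmL-uniform : lcmL G ≡ k
  lcmL-uniform = foldr-tabulate-idem lcm (lcm[n,1]≡n k) (lcm[n,n]≡n k) _ uniform

CopWinningCycle : ℕ → ℕ → Set
CopWinningCycle k ℓ = Σ ℕ λ n → Σ (EPCycle n) λ G → CopWinning G × maxL G ≡ k × n ≡ 2 * ℓ * lcmL G ∸ 1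

module _ {N : ℕ} where

  toℕ-next : (i : Fin (suc N)) → toℕ (next i) ≡ suc (toℕ i) % suc N
  toℕ-next i = toℕ-fromℕ< (m%n<n (suc (toℕ i)) (suc N))

  toℕ-next-< : (i : Fin (suc N)) → toℕ i < N → toℕ (next i) ≡ suc (toℕ i)
  toℕ-next-< i i<N = trans (toℕ-next i) (m<n⇒m%n≡m (s≤s i<N))

  toℕ-next-last : (i : Fin (suc N)) → toℕ i ≡ N → toℕ (next i) ≡ 0
  toℕ-next-last i i≡N = trans (toℕ-next i) (trans (cong (λ x → suc x % suc N) i≡N) (n%n≡0 (suc N)))

  toℕ<⊎≡last : (i : Fin (suc N)) → toℕ i < N ⊎ toℕ i ≡ N
  toℕ<⊎≡last i with toℕ i <? N
  ... | yes i<N = inj₁ i<N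
  ... | no  i≮N = inj₂ (≤-antisym (toℕ≤pred[n] i) (≮⇒≥ i≮N))

  toℕ≡suc⇒suc≤N : ∀ {i : Fin (suc N)} {x} → toℕ i ≡ suc x → suc x ≤ N
  toℕ≡suc⇒suc≤N {i} i≡1+x = subst (_≤ N) i≡1+x (toℕ≤pred[n] i)

module CycleGame (N : ℕ) (3≤n : 3 ≤ suc N) (pat : ℕ → List Bool) {p : ℕ}
                 (length-pat : ∀ x → length (pat x) ≡ suc p) (true∈pat : ∀ x → true ∈ pat x) where

  cycle : EPCycle (suc N)
  cycle = record
    { n≥3      = 3≤n
    ; τ        = pat ∘′ toℕ
    ; nonempty = λ i → subst (1 ≤_) (sym (length-pat (toℕ i))) (s≤s z≤n)
    ; occurs   = λ i → true∈pat (toℕ i)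
    }

  Present : ℕ → ℕ → Set
  Present x t = at (pat x) t ≡ true

  data MoveView (t : ℕ) : ℕ → ℕ → Set where
    stay      : ∀ {x} → MoveView t x x
    right     : ∀ {x} → x < N → Present x t → MoveView t x (suc x)
    wrapRight : Present N t → MoveView t N 0
    left      : ∀ {y} → Present y t → MoveView t (suc y) y
    wrapLeft  : Present N t → MoveView t 0 N

  view : ∀ {t u v} → Move cycle t u v → MoveView t (toℕ u) (toℕ v)
  view (inj₁ refl) = stay
  view {t} {u} (inj₂ (inj₁ (refl , p))) with toℕ<⊎≡last u
  ... | inj₁ u<N = subst (MoveView t (toℕ u)) (sym (toℕ-next-< u u<N)) (right u<N p)
  ... | inj₂ u≡N = subst₂ (MoveView t) (sym u≡N) (sym (toℕ-next-last u u≡N))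
                     (wrapRight (subst (λ x → Present x t) u≡N p))
  view {t} {v = v} (inj₂ (inj₂ (refl , p))) with toℕ<⊎≡last v
  ... | inj₁ v<N = subst (λ x → MoveView t x (toℕ v)) (sym (toℕ-next-< v v<N)) (left p)
  ... | inj₂ v≡N = subst₂ (MoveView t) (sym (toℕ-next-last v v≡N)) (sym v≡N)
                     (wrapLeft (subst (λ x → Present x t) v≡N p))

  moveRight : ∀ {t} c → Present (toℕ c) t → Move cycle t c (next c)
  moveRight c p = inj₂ (inj₁ (refl , p))

  reflect : Fin (suc N) → Fin (suc N)
  reflect i = fromℕ< (m%n<n (suc N ∸ toℕ i) (suc N))

  toℕ-reflect-0 : ∀ {i} → toℕ i ≡ 0 → toℕ (reflect i) ≡ 0
  toℕ-reflect-0 {i} i≡0 = begin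
    toℕ (reflect i)            ≡⟨ toℕ-fromℕ< (m%n<n (suc N ∸ toℕ i) (suc N)) ⟩
    (suc N ∸ toℕ i) % suc N    ≡⟨ cong (λ x → (suc N ∸ x) % suc N) i≡0 ⟩
    suc N % suc N              ≡⟨ n%n≡0 (suc N) ⟩
    0                          ∎
    where open ≡-Reasoning

  toℕ-reflect-suc : ∀ {i x} → toℕ i ≡ suc x → toℕ (reflect i) ≡ N ∸ x
  toℕ-reflect-suc {i} {x} i≡1+x = begin
    toℕ (reflect i)            ≡⟨ toℕ-fromℕ< (m%n<n (suc N ∸ toℕ i) (suc N)) ⟩
    (suc N ∸ toℕ i) % suc N    ≡⟨ cong (λ y → (suc N ∸ y) % suc N) i≡1+x ⟩
    (N ∸ x) % suc N            ≡⟨ m<n⇒m%n≡m (s≤s (m∸n≤m N x)) ⟩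
    N ∸ x                      ∎
    where open ≡-Reasoning

  reflect-involutive : ∀ i → reflect (reflect i) ≡ i
  reflect-involutive i = toℕ-injective (go (toℕ i) refl)
    where
      go : ∀ x → toℕ i ≡ x → toℕ (reflect (reflect i)) ≡ toℕ i
      go zero    i≡0   = trans (toℕ-reflect-0 (toℕ-reflect-0 i≡0)) (sym i≡0)
      go (suc x) i≡1+x = begin
        toℕ (reflect (reflect i)) ≡⟨ toℕ-reflect-suc (trans (toℕ-reflect-suc i≡1+x) (sym (1+[m∸1+n]≡m∸n 1+x≤N))) ⟩
        N ∸ (N ∸ suc x)           ≡⟨ m∸[m∸n]≡n 1+x≤N ⟩
        suc x                     ≡⟨ sym i≡1+x ⟩
        toℕ i                     ∎
        where
          open ≡-Reasoning
          1+x≤N : suc x ≤ N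
          1+x≤N = toℕ≡suc⇒suc≤N i≡1+x

  toℕ-reflect-next : ∀ u → toℕ (reflect (next u)) ≡ N ∸ toℕ u
  toℕ-reflect-next u with toℕ<⊎≡last u
  ... | inj₁ u<N = toℕ-reflect-suc (toℕ-next-< u u<N)
  ... | inj₂ u≡N = trans (toℕ-reflect-0 (toℕ-next-last u u≡N)) (sym (trans (cong (N ∸_) u≡N) (n∸n≡0 N)))

  next-reflect-next : ∀ u → next (reflect (next u)) ≡ reflect u
  next-reflect-next u = toℕ-injective (go (toℕ u) refl)
    where
      go : ∀ x → toℕ u ≡ x → toℕ (next (reflect (next u))) ≡ toℕ (reflect u)
      go zero    u≡0   = trans (toℕ-next-last _ (trans (toℕ-reflect-next u) (cong (N ∸_) u≡0)))
                               (sym (toℕ-reflect-0 u≡0))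
      go (suc y) u≡1+y = begin
        toℕ (next (reflect (next u))) ≡⟨ toℕ-next-< _ (subst (_< N) (sym reflect-next≡) (∸-monoʳ-< (s≤s z≤n) 1+y≤N)) ⟩
        suc (toℕ (reflect (next u)))  ≡⟨ cong suc reflect-next≡ ⟩
        suc (N ∸ suc y)               ≡⟨ 1+[m∸1+n]≡m∸n 1+y≤N ⟩
        N ∸ y                         ≡⟨ sym (toℕ-reflect-suc u≡1+y) ⟩
        toℕ (reflect u)               ∎
        where
          open ≡-Reasoning
          1+y≤N : suc y ≤ N
          1+y≤N = toℕ≡suc⇒suc≤N u≡1+y
          reflect-next≡ : toℕ (reflect (next u)) ≡ N ∸ suc y
          reflect-next≡ = trans (toℕ-reflect-next u) (cong (N ∸_) u≡1+y)

  reflect-0 : reflect fzero ≡ fzero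
  reflect-0 = toℕ-injective (toℕ-reflect-0 refl)

  module _ (symmetric : ∀ x → x ≤ N → pat (N ∸ x) ≡ pat x) where

    reflect-present : ∀ {t} u → Present (toℕ u) t → Present (toℕ (reflect (next u))) t
    reflect-present {t} u = subst (λ xs → at xs t ≡ true) (sym pat-reflect-next)
      where
        pat-reflect-next : pat (toℕ (reflect (next u))) ≡ pat (toℕ u)
        pat-reflect-next = trans (cong pat (toℕ-reflect-next u)) (symmetric (toℕ u) (toℕ≤pred[n] u))

    reflect-move : ∀ {t u v} → Move cycle t u v → Move cycle t (reflect u) (reflect v)
    reflect-move (inj₁ refl)              = inj₁ refl
    reflect-move (inj₂ (inj₁ (refl , p))) = inj₂ (inj₂ (sym (next-reflect-next _) , reflect-present _ p))
    reflect-move (inj₂ (inj₂ (refl , p))) = inj₂ (inj₁ (sym (next-reflect-next _) , reflect-present _ p))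

    reflect-CopWins : ∀ {c r t} → CopWins cycle c r t → CopWins cycle (reflect c) (reflect r) t
    reflect-CopWins (catch c′ m c′≡r) = catch (reflect c′) (reflect-move m) (cong reflect c′≡r)
    reflect-CopWins {r = r} {t} (step c′ m wins) = step (reflect c′) (reflect-move m) λ r′ m′ →
      subst (λ x → CopWins cycle (reflect c′) x (suc t)) (reflect-involutive r′)
        (reflect-CopWins (wins (reflect r′) (subst (λ x → Move cycle t x (reflect r′)) (reflect-involutive r) (reflect-move m′))))

    copWinning-by-symmetry : ∀ h → N ≡ h + h → (∀ r → toℕ r ≤ h → CopWins cycle fzero r 0) →
                             CopWinning cycle
    copWinning-by-symmetry h N≡2h wins = fzero , λ r → go r (toℕ r) refl
      where
        go : ∀ r x → toℕ r ≡ x → CopWins cycle fzero r 0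
        go r x r≡x with x ≤? h
        ... | yes x≤h = wins r (subst (_≤ h) (sym r≡x) x≤h)
        go r zero    r≡0   | no 0≰h = ⊥-elim (0≰h z≤n)
        go r (suc x) r≡1+x | no 1+x≰h =
          subst₂ (λ c r′ → CopWins cycle c r′ 0) reflect-0 (reflect-involutive r)
            (reflect-CopWins (wins (reflect r) reflect-r≤h))
          where
            reflect-r≤h : toℕ (reflect r) ≤ h
            reflect-r≤h = begin
              toℕ (reflect r) ≡⟨ toℕ-reflect-suc r≡1+x ⟩
              N ∸ x           ≡⟨ cong (_∸ x) N≡2h ⟩
              (h + h) ∸ x     ≤⟨ ∸-monoʳ-≤ (h + h) (≤-pred (≰⇒> 1+x≰h)) ⟩
              (h + h) ∸ h     ≡⟨ m+n∸n≡m h h ⟩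
              h               ∎
              where open ≤-Reasoning

  -- The cop walks from t to T along the edges Present t t; Inv t x says where the robber can be
  -- when the cop stands on t, except on t and t + 1, where it is caught.
  module _ (Inv : ℕ → ℕ → Set) {T} (T≤N : T ≤ N)
           (cop-edge : ∀ {t} → t < T → Present t t)
           (preserve : ∀ {t x y} → t < T → Inv t x → x ≢ t → x ≢ suc t → MoveView t x y → Inv (suc t) y)
           (finish : ∀ c r → toℕ c ≡ T → Inv T (toℕ r) → CopWins cycle c r T) where

    sweep : ∀ d {t} c r → d + t ≡ T → toℕ c ≡ t → Inv t (toℕ r) → CopWins cycle c r t
    sweep zero        c r refl  c≡T inv = finish c r c≡T inv
    sweep (suc d) {t} c r d+t≡T c≡t inv = advance (toℕ r ≟ t) (toℕ r ≟ suc t)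
      where
        t<T : t < T
        t<T = subst (t <_) d+t≡T (m<n+m t (s≤s z≤n))

        forward : Move cycle t c (next c)
        forward = moveRight c (subst (λ x → Present x t) (sym c≡t) (cop-edge t<T))

        next-c≡1+t : toℕ (next c) ≡ suc t
        next-c≡1+t = trans (toℕ-next-< c (subst (_< N) (sym c≡t) (<-≤-trans t<T T≤N))) (cong suc c≡t)

        advance : Dec (toℕ r ≡ t) → Dec (toℕ r ≡ suc t) → CopWins cycle c r t
        advance (yes r≡t) _           = catch c (inj₁ refl) (toℕ-injective (trans c≡t (sym r≡t)))
        advance (no _)    (yes r≡1+t) = catch (next c) forward (toℕ-injective (trans next-c≡1+t (sym r≡1+t)))
        advance (no r≢t)  (no r≢1+t)  = step (next c) forward λ r′ m →
          sweep d (next c) r′ (trans (+-suc d t) d+t≡T) next-c≡1+t (preserve t<T inv r≢t r≢1+t (view m))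

  witness : ∀ ℓ → CopWinning cycle → suc N + 1 ≡ 2 * ℓ * suc p → CopWinningCycle (suc p) ℓ
  witness ℓ win size = suc N , cycle , win , maxL-uniform cycle (λ i → length-pat (toℕ i)) ,
    (begin
      suc N                          ≡⟨ m+n∸n≡m (suc N) 1 ⟨
      suc N + 1 ∸ 1                  ≡⟨ cong (_∸ 1) size ⟩
      2 * ℓ * suc p ∸ 1              ≡⟨ cong (λ l → 2 * ℓ * l ∸ 1) (lcmL-uniform cycle (λ i → length-pat (toℕ i))) ⟨
      2 * ℓ * lcmL cycle ∸ 1         ∎)
    where open ≡-Reasoning

module Slots (m : ℕ) where

  k : ℕ
  k = suc (suc m)

  full firstOnly lastOnly : List Bool
  full      = always k
  firstOnly = pulse 0 (suc m)
  lastOnly  = pulse (suc m) 0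

  length-full : length full ≡ k
  length-full = length-replicate k

  length-firstOnly : length firstOnly ≡ k
  length-firstOnly = length-pulse 0 (suc m)

  length-lastOnly : length lastOnly ≡ k
  length-lastOnly = trans (length-pulse (suc m) 0) (cong (suc ∘′ suc) (+-identityʳ m))

  at-full : ∀ t → at full t ≡ true
  at-full = at-always (suc m)

  at-firstOnly : ∀ t → at firstOnly t ≡ true ⇔ t % k ≡ 0
  at-firstOnly = at-pulse 0 (suc m)

  at-lastOnly : ∀ t → at lastOnly t ≡ true ⇔ t % k ≡ suc m
  at-lastOnly t = subst (λ q → at lastOnly t ≡ true ⇔ t % suc q ≡ suc m) (+-identityʳ (suc m)) (at-pulse (suc m) 0 t)

module SingleGate (m : ℕ) where
  open Slots m

  h N : ℕ
  h = suc m
  N = h + h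

  schedule : ℕ → List Bool
  schedule x with x ≟ h
  ... | yes _ = lastOnly
  ... | no  _ = full

  schedule-h : schedule h ≡ lastOnly
  schedule-h with h ≟ h
  ... | yes _   = refl
  ... | no  h≢h = ⊥-elim (h≢h refl)

  schedule-≢ : ∀ {x} → x ≢ h → schedule x ≡ full
  schedule-≢ {x} x≢h with x ≟ h
  ... | yes x≡h = ⊥-elim (x≢h x≡h)
  ... | no  _   = refl

  length-schedule : ∀ x → length (schedule x) ≡ k
  length-schedule x with x ≟ h
  ... | yes _ = length-lastOnly
  ... | no  _ = length-full

  true∈schedule : ∀ x → true ∈ schedule x
  true∈schedule x with x ≟ h
  ... | yes _ = true∈pulse (suc m) 0
  ... | no  _ = here refl

  schedule-symmetric : ∀ x → x ≤ N → schedule (N ∸ x) ≡ schedule x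
  schedule-symmetric x x≤N with x ≟ h
  ... | yes refl = trans (cong schedule (m+n∸n≡m h h)) schedule-h
  ... | no  x≢h  = schedule-≢ λ N∸x≡h → x≢h (trans (m∸n≡o⇒n≡m∸o x≤N N∸x≡h) (m+n∸n≡m h h))

  open CycleGame N (s≤s (s≤s (≤-trans (s≤s z≤n) (m≤n+m (suc m) m)))) schedule length-schedule true∈schedule

  present-≢ : ∀ {x t} → x ≢ h → Present x t
  present-≢ {t = t} x≢h = subst (λ xs → at xs t ≡ true) (sym (schedule-≢ x≢h)) (at-full t)

  present-h : ∀ {t} → Present h t → t % k ≡ h
  present-h {t} p = to (at-lastOnly t) (subst (λ xs → at xs t ≡ true) schedule-h p)

  Ahead : ℕ → ℕ → Set
  Ahead t x = t ≤ x × x ≤ h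

  ahead-step : ∀ {t x y} → t < h → suc (suc t) ≤ x → x ≤ h → MoveView t x y → Ahead (suc t) y
  ahead-step _   2+t≤x x≤h stay        = <⇒≤ 2+t≤x , x≤h
  ahead-step t<h 2+t≤x x≤h (right _ p) = m≤n⇒m≤1+n (<⇒≤ 2+t≤x) , ≤∧≢⇒< x≤h x≢h
    where
      x≢h : _ ≢ h
      x≢h refl = <⇒≢ t<h (trans (sym (m<n⇒m%n≡m (m<n⇒m<1+n t<h))) (present-h p))
  ahead-step _   _     x≤h (wrapRight _) = ⊥-elim (<⇒≱ (m<m+n h (s≤s z≤n)) x≤h)
  ahead-step _   (s≤s 1+t≤y) x≤h (left _) = 1+t≤y , ≤-trans (n≤1+n _) x≤h
  ahead-step _   ()    _   (wrapLeft _)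

  cop-winning : CopWinning cycle
  cop-winning = copWinning-by-symmetry schedule-symmetric h refl λ r r≤h →
    sweep Ahead (m≤m+n h h) (λ t<h → present-≢ (<⇒≢ t<h))
      (λ t<h (t≤x , x≤h) x≢t x≢1+t → ahead-step t<h (≤∧≢∧≢⇒2+≤ t≤x x≢t x≢1+t) x≤h)
      (λ c r c≡h (h≤r , r≤h) → catch c (inj₁ refl) (toℕ-injective (trans c≡h (≤-antisym h≤r r≤h))))
      h fzero r (+-identityʳ h) refl (z≤n , r≤h)

  example : CopWinningCycle k 1
  example = witness 1 cop-winning (size m)
    where
      size : ∀ m → suc (suc m + suc m) + 1 ≡ 2 * 1 * suc (suc m)
      size = solve-∀

module GateWithDoors (m : ℕ) where
  open Slots m

  H N : ℕ
  H = k + suc m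
  N = H + H

  Door : ℕ → Set
  Door x = x ≡ 0 ⊎ x ≡ N

  door? : ∀ x → Dec (Door x)
  door? x = x ≟ 0 ⊎-dec x ≟ N

  schedule : ℕ → List Bool
  schedule x with door? x | x ≟ H
  ... | yes _ | _     = firstOnly
  ... | no  _ | yes _ = lastOnly
  ... | no  _ | no  _ = full

  H<N : H < N
  H<N = m<m+n H (s≤s z≤n)

  ¬door-H : ¬ Door H
  ¬door-H (inj₁ ())
  ¬door-H (inj₂ H≡N) = <⇒≢ H<N H≡N

  schedule-door : ∀ {x} → Door x → schedule x ≡ firstOnly
  schedule-door {x} door with door? x
  ... | yes _     = refl
  ... | no  ¬door = ⊥-elim (¬door door)

  schedule-H : schedule H ≡ lastOnly
  schedule-H with door? H | H ≟ H
  ... | yes door | _       = ⊥-elim (¬door-H door)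
  ... | no  _    | yes _   = refl
  ... | no  _    | no  H≢H = ⊥-elim (H≢H refl)

  schedule-other : ∀ {x} → ¬ Door x → x ≢ H → schedule x ≡ full
  schedule-other {x} ¬door x≢H with door? x | x ≟ H
  ... | yes door | _       = ⊥-elim (¬door door)
  ... | no  _    | yes x≡H = ⊥-elim (x≢H x≡H)
  ... | no  _    | no  _   = refl

  length-schedule : ∀ x → length (schedule x) ≡ k
  length-schedule x with door? x | x ≟ H
  ... | yes _ | _     = length-firstOnly
  ... | no  _ | yes _ = length-lastOnly
  ... | no  _ | no  _ = length-full

  true∈schedule : ∀ x → true ∈ schedule x
  true∈schedule x with door? x | x ≟ H
  ... | yes _ | _     = here refl
  ... | no  _ | yes _ = true∈pulse (suc m) 0
  ... | no  _ | no  _ = here refl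

  door-reflect : ∀ {x} → x ≤ N → Door x → Door (N ∸ x)
  door-reflect _   (inj₁ refl) = inj₂ refl
  door-reflect _   (inj₂ refl) = inj₁ (n∸n≡0 N)

  door-reflect⁻¹ : ∀ {x} → x ≤ N → Door (N ∸ x) → Door x
  door-reflect⁻¹ x≤N (inj₁ N∸x≡0) = inj₂ (m∸n≡o⇒n≡m∸o x≤N N∸x≡0)
  door-reflect⁻¹ x≤N (inj₂ N∸x≡N) = inj₁ (trans (m∸n≡o⇒n≡m∸o x≤N N∸x≡N) (n∸n≡0 N))

  schedule-symmetric : ∀ x → x ≤ N → schedule (N ∸ x) ≡ schedule x
  schedule-symmetric x x≤N with door? x | x ≟ H
  ... | yes door  | _        = schedule-door (door-reflect x≤N door)
  ... | no  _     | yes refl = trans (cong schedule (m+n∸n≡m H H)) schedule-H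
  ... | no  ¬door | no  x≢H  = schedule-other (¬door ∘′ door-reflect⁻¹ x≤N) N∸x≢H
    where
      N∸x≢H : N ∸ x ≢ H
      N∸x≢H N∸x≡H = x≢H (trans (m∸n≡o⇒n≡m∸o x≤N N∸x≡H) (m+n∸n≡m H H))

  open CycleGame N (s≤s (s≤s (s≤s z≤n))) schedule length-schedule true∈schedule

  present-door : ∀ {x} → Door x → ∀ t → Present x t ⇔ t % k ≡ 0
  present-door door t = subst (λ xs → at xs t ≡ true ⇔ t % k ≡ 0) (sym (schedule-door door)) (at-firstOnly t)

  present-H : ∀ t → Present H t ⇔ t % k ≡ suc m
  present-H t = subst (λ xs → at xs t ≡ true ⇔ t % k ≡ suc m) (sym schedule-H) (at-lastOnly t)

  present-other : ∀ {x t} → ¬ Door x → x ≢ H → Present x t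
  present-other {t = t} ¬door x≢H = subst (λ xs → at xs t ≡ true) (sym (schedule-other ¬door x≢H)) (at-full t)

  H%k≡1+m : H % k ≡ suc m
  H%k≡1+m = trans (cong (_% k) (+-comm k (suc m))) (trans ([m+n]%n≡m%n (suc m) k) (m<n⇒m%n≡m ≤-refl))

  cop-edge : ∀ {t} → t < N → Present t t
  cop-edge {t} t<N = edge (t ≟ 0) (t ≟ H)
    where
      edge : Dec (t ≡ 0) → Dec (t ≡ H) → Present t t
      edge (yes t≡0) _         = subst (λ x → Present x x) (sym t≡0) (from (present-door (inj₁ refl) 0) refl)
      edge (no  _)   (yes t≡H) = subst (λ x → Present x x) (sym t≡H) (from (present-H H) H%k≡1+m)
      edge (no  t≢0) (no  t≢H) = present-other [ t≢0 , <⇒≢ t<N ] t≢H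

  -- A robber past the gate crossed it at a time ≥ k − 1, so it is at most k ahead of the cop;
  -- one that wrapped round to 0 did so too late for the doors at 0 to reopen before time N.
  data Chase (t x : ℕ) : Set where
    beforeGate : t ≤ x → x ≤ H → Chase t x
    pastGate   : k ≤ t → t ≤ x → H < x → x ≤ t + k → x ≤ N → Chase t x
    atOrigin   : x ≡ 0 → (∀ s → t ≤ s → s < N → s % k ≢ 0) → Chase t x

  gate-open⇒1+m≤t : ∀ {t} → Present H t → suc m ≤ t
  gate-open⇒1+m≤t {t} p = subst (_≤ t) (to (present-H t) p) (m%n≤m t k)

  cross-gate : ∀ {t} → Present H t → suc H ≤ suc t + k
  cross-gate {t} p = s≤s (subst (_≤ t + k) (+-comm (suc m) k) (+-monoˡ-≤ k (gate-open⇒1+m≤t p)))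

  before-right : ∀ {t x} → suc (suc t) ≤ x → x ≤ H → Present x t → Dec (x ≡ H) → Chase (suc t) (suc x)
  before-right 2+t≤x x≤H _ (no x≢H) = beforeGate (m≤n⇒m≤1+n (<⇒≤ 2+t≤x)) (≤∧≢⇒< x≤H x≢H)
  before-right 2+t≤x _   p (yes refl) =
    pastGate (s≤s (gate-open⇒1+m≤t p)) (m≤n⇒m≤1+n (<⇒≤ 2+t≤x)) ≤-refl (cross-gate p) H<N

  before-step : ∀ {t x y} → suc (suc t) ≤ x → x ≤ H → MoveView t x y → Chase (suc t) y
  before-step 2+t≤x x≤H stay            = beforeGate (<⇒≤ 2+t≤x) x≤H
  before-step 2+t≤x x≤H (right _ p)     = before-right 2+t≤x x≤H p (_ ≟ H)
  before-step _     x≤H (wrapRight _)   = ⊥-elim (<⇒≱ H<N x≤H)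
  before-step (s≤s 1+t≤y) x≤H (left _)  = beforeGate 1+t≤y (≤-trans (n≤1+n _) x≤H)
  before-step ()    _   (wrapLeft _)

  past-left : ∀ {t y} → k ≤ t → suc (suc t) ≤ suc y → H < suc y → suc y ≤ t + k → suc y ≤ N →
              Present y t → Dec (y ≡ H) → Chase (suc t) y
  past-left k≤t (s≤s 1+t≤y) H<1+y 1+y≤t+k 1+y≤N _ (no y≢H) =
    pastGate (m≤n⇒m≤1+n k≤t) 1+t≤y (≤∧≢⇒< (≤-pred H<1+y) (≢-sym y≢H)) (m≤n⇒m≤1+n (<⇒≤ 1+y≤t+k)) (<⇒≤ 1+y≤N)
  past-left {t} k≤t (s≤s 1+t≤H) _ _ _ p (yes refl) = ⊥-elim (<⇒≱ 1+t≤H H≤t)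
    where
      H≤t : H ≤ t
      H≤t = subst (λ r → k + r ≤ t) (to (present-H t) p) (m≤n⇒m+n%m≤n k≤t)

  past-step : ∀ {t x y} → k ≤ t → suc (suc t) ≤ x → H < x → x ≤ t + k → x ≤ N →
              MoveView t x y → Chase (suc t) y
  past-step k≤t 2+t≤x H<x x≤t+k x≤N stay =
    pastGate (m≤n⇒m≤1+n k≤t) (<⇒≤ 2+t≤x) H<x (m≤n⇒m≤1+n x≤t+k) x≤N
  past-step k≤t 2+t≤x H<x x≤t+k _ (right x<N _) =
    pastGate (m≤n⇒m≤1+n k≤t) (m≤n⇒m≤1+n (<⇒≤ 2+t≤x)) (m<n⇒m<1+n H<x) (s≤s x≤t+k) x<N
  past-step {t} _ _ _ N≤t+k _ (wrapRight p) = atOrigin refl λ s 1+t≤s s<N s%k≡0 →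
    <⇒≱ s<N (≤-trans N≤t+k (∣∧∣∧<⇒+≤ (m%n≡0⇒n∣m t k (to (present-door (inj₂ refl) t) p)) (m%n≡0⇒n∣m s k s%k≡0) 1+t≤s))
  past-step k≤t 2+t≤x H<x x≤t+k x≤N (left p) = past-left k≤t 2+t≤x H<x x≤t+k x≤N p (_ ≟ H)
  past-step _ () _ _ _ (wrapLeft _)

  origin-step : ∀ {t y} → t < N → (∀ s → t ≤ s → s < N → s % k ≢ 0) → MoveView t 0 y → Chase (suc t) y
  origin-step _   clear stay         = atOrigin refl λ s 1+t≤s → clear s (<⇒≤ 1+t≤s)
  origin-step {t} t<N clear (right _ p)  = ⊥-elim (clear t ≤-refl t<N (to (present-door (inj₁ refl) t) p))
  origin-step {t} t<N clear (wrapLeft p) = ⊥-elim (clear t ≤-refl t<N (to (present-door (inj₂ refl) t) p))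

  chase-step : ∀ {t x y} → t < N → Chase t x → x ≢ t → x ≢ suc t → MoveView t x y → Chase (suc t) y
  chase-step _ (beforeGate t≤x x≤H) x≢t x≢1+t = before-step (≤∧≢∧≢⇒2+≤ t≤x x≢t x≢1+t) x≤H
  chase-step _ (pastGate k≤t t≤x H<x x≤t+k x≤N) x≢t x≢1+t =
    past-step k≤t (≤∧≢∧≢⇒2+≤ t≤x x≢t x≢1+t) H<x x≤t+k x≤N
  chase-step t<N (atOrigin refl clear) _ _ = origin-step t<N clear

  wait : ∀ d {t} c r → toℕ c ≡ N → toℕ r ≡ 0 → k ∣ d + t → CopWins cycle c r t
  wait d {t} c r c≡N r≡0 k∣d+t with t % k ≟ 0
  ... | yes t%k≡0 = catch (next c) (moveRight c door-open) (toℕ-injective (trans (toℕ-next-last c c≡N) (sym r≡0)))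
    where
      door-open : Present (toℕ c) t
      door-open = subst (λ x → Present x t) (sym c≡N) (from (present-door (inj₂ refl) t) t%k≡0)
  wait zero    {t} c r _   _   k∣t   | no t%k≢0 = ⊥-elim (t%k≢0 (n∣m⇒m%n≡0 t k k∣t))
  wait (suc d) {t} c r c≡N r≡0 k∣d+t | no t%k≢0 = step c (inj₁ refl) λ r′ m →
    wait d c r′ c≡N (stuck r≡0 (view m)) (subst (k ∣_) (sym (+-suc d t)) k∣d+t)
    where
      stuck : ∀ {x y} → x ≡ 0 → MoveView t x y → y ≡ 0
      stuck refl stay         = refl
      stuck refl (right _ p)  = ⊥-elim (t%k≢0 (to (present-door (inj₁ refl) t) p))
      stuck refl (wrapLeft p) = ⊥-elim (t%k≢0 (to (present-door (inj₂ refl) t) p))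

  2+N≡4k : 2 + N ≡ 4 * k
  2+N≡4k = lemma m
    where
      lemma : ∀ m → 2 + ((suc (suc m) + suc m) + (suc (suc m) + suc m)) ≡ 4 * suc (suc m)
      lemma = solve-∀

  finish : ∀ c r → toℕ c ≡ N → Chase N (toℕ r) → CopWins cycle c r N
  finish c r c≡N (beforeGate N≤r r≤H)     = ⊥-elim (<⇒≱ H<N (≤-trans N≤r r≤H))
  finish c r c≡N (pastGate _ N≤r _ _ r≤N) = catch c (inj₁ refl) (toℕ-injective (trans c≡N (≤-antisym N≤r r≤N)))
  finish c r c≡N (atOrigin r≡0 _)         = wait 2 c r c≡N r≡0 (subst (k ∣_) (sym 2+N≡4k) (n∣m*n 4))

  cop-winning : CopWinning cycle
  cop-winning = copWinning-by-symmetry schedule-symmetric H refl λ r r≤H →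
    sweep Chase ≤-refl cop-edge chase-step finish N fzero r (+-identityʳ N) refl (beforeGate z≤n r≤H)

  example : CopWinningCycle k 2
  example = witness 2 cop-winning (size m)
    where
      size : ∀ m → suc ((suc (suc m) + suc m) + (suc (suc m) + suc m)) + 1 ≡ 2 * 2 * suc (suc m)
      size = solve-∀

theorem3 : (k : ℕ) → 2 ≤ k → (ℓ : ℕ) → (ℓ ≡ 1 ⊎ ℓ ≡ 2) →
    Σ ℕ λ n → Σ (EPCycle n) λ G →
      CopWinning G × maxL G ≡ k × n ≡ 2 * ℓ * lcmL G ∸ 1
theorem3 (suc (suc m)) _ _ (inj₁ refl) = SingleGate.example m
theorem3 (suc (suc m)) _ _ (inj₂ refl) = GateWithDoors.example m
theorem3 1 (s≤s ()) _ _
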